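{- Let $\mathcal{N}$ be a finite subset of $\mathbb{Z}^d\setminus\{0^d\}$. For every finite non-empty set $X\subset\mathbb{Z}^d$, let $X_{\mathrm{in}}=\{(y,x): y\notin X,\ x\in X,\ y\in x-\mathcal{N}\}$ and $X_{\mathrm{out}}=\{(x,y): x\in X,\ y\notin X,\ y\in x+\mathcal{N}\}$. Then there exists a bijection $\lambda:X_{\mathrm{in}}\to X_{\mathrm{out}}$ such that $\lambda((y,x))=(x',y')$ implies $x+x'=y+y'$.
   Context: $x+\mathcal{N}=\{x+v: v\in\mathcal{N}\}$ and $x-\mathcal{N}=\{x-v: v\in\mathcal{N}\}$. -}

module Defs where

open import Data.Nat using (ℕ)
open import Data.Integer as ℤ using (ℤ)
import Data.Integer.Properties as ℤP
open import Data.Vec using (Vec; zipWith; replicate)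
open import Data.Vec.Properties using (≡-dec)
open import Data.List using (List)
open import Data.List.Membership.DecPropositional as DecMem using ()
open import Data.Product using (Σ; _×_; _,_)
open import Relation.Nullary.Decidable using (True; False)
open import Relation.Binary.PropositionalEquality using (_≡_)

Pt : ℕ → Set
Pt d = Vec ℤ d

0ᵈ : ∀ {d} → Pt d
0ᵈ = replicate _ (ℤ.+ 0)

_+ᵥ_ : ∀ {d} → Pt d → Pt d → Pt d
_+ᵥ_ = zipWith ℤ._+_

_-ᵥ_ : ∀ {d} → Pt d → Pt d → Pt d
_-ᵥ_ = zipWith ℤ._-_

_∈?_ : ∀ {d} → (v : Pt d) → (S : List (Pt d)) → _
_∈?_ {d} = DecMem._∈?_ (≡-dec ℤ._≟_)

-- X_in = {(y,x) : y ∉ X, x ∈ X, y ∈ x - N}   (y ∈ x - N  ⇔  x - y ∈ N)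
Xin : ∀ {d} → List (Pt d) → List (Pt d) → Set
Xin {d} N X = Σ (Pt d × Pt d) λ { (y , x) →
  False (y ∈? X) × True (x ∈? X) × True ((x -ᵥ y) ∈? N) }

-- X_out = {(x,y) : x ∈ X, y ∉ X, y ∈ x + N}   (y ∈ x + N  ⇔  y - x ∈ N)
Xout : ∀ {d} → List (Pt d) → List (Pt d) → Set
Xout {d} N X = Σ (Pt d × Pt d) λ { (x , y) →
  True (x ∈? X) × False (y ∈? X) × True ((y -ᵥ x) ∈? N) }

module Submission where

-- Fix a direction v ∈ N.  The pairs (y , x) of X_in with x - y = v
-- are exactly the points x ∈ X with x - v ∉ X, i.e. the starting points of the
-- maximal runs  x, x + v, x + 2v, …  inside X; the pairs (x' , y') of X_out with
-- y' - x' = v are the end points of such runs.  Since v ≠ 0 and X is finite,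
-- every run is finite, so "start of a run ↦ end of the same run" is a bijection
-- whose inverse walks the run backwards.  This gives
--   λ (x - v , x) = (e , e + v),   e the end of the run starting at x,
-- and then  x + e = (x - v) + (e + v)  is the required identity.

open import Defs
open import Data.Nat using (ℕ; zero; suc; _≤_; z≤n; s≤s; s≤s⁻¹)
open import Data.Nat.Properties using (<⇒≢; n<1+n)
open import Data.Nat.GeneralisedArithmetic using (iterate)
open import Data.Integer as ℤ using (ℤ; +_; +[1+_]; -[1+_]; 0ℤ)
import Data.Integer.Properties as ℤP
open import Data.Integer.Tactic.RingSolver using (solve-∀)
open import Data.Bool using (Bool; T)
open import Data.Bool.Properties using (T-irrelevant)
open import Data.Vec using ([]; _∷_; map)
open import Data.Vec.Properties using (≡-dec; ∷-injective)
open import Data.List using (List; []; length; lookup)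
open import Data.List.Relation.Unary.All using (All)
import Data.List.Relation.Unary.All as All
open import Data.List.Relation.Unary.Any using (index)
open import Data.List.Relation.Unary.Any.Properties using (lookup-index)
open import Data.List.Membership.Propositional using (_∈_; _∉_)
import Data.List.Membership.DecPropositional as DecMembership
open import Data.Fin using (Fin; toℕ)
open import Data.Fin.Properties using (pigeonhole; toℕ<n)
open import Data.Product using (Σ; ∃; ∃₂; _×_; _,_; proj₁; proj₂)
open import Data.Sum using (_⊎_; inj₁; inj₂; [_,_]′; map₂)
open import Data.Empty using (⊥-elim)
open import Function using (id; _∘_)
open import Function.Bundles using (_⤖_; Bijection; mk↔ₛ′)
open import Function.Properties.Inverse using (↔⇒⤖)
open import Relation.Nullary using (¬_; Dec; yes; no)
open import Relation.Nullary.Decidable using (True; toWitness; fromWitness; toWitnessFalse; fromWitnessFalse)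
open import Relation.Binary.Definitions using (DecidableEquality)
open import Relation.Binary.PropositionalEquality
  using (_≡_; _≢_; refl; sym; trans; cong; cong₂; subst; module ≡-Reasoning)

Aperiodic : {A : Set} → (A → A) → Set
Aperiodic {A} s = ∀ (p : A) {i j : ℕ} → iterate s p i ≡ iterate s p j → i ≡ j

module Runs {A : Set} (_≟_ : DecidableEquality A) (X : List A) where
  _∈X? : ∀ a → Dec (a ∈ X)
  a ∈X? = DecMembership._∈?_ _≟_ a X

  collision : ∀ {f : ℕ → A} → (∀ i → i ≤ length X → f i ∈ X) →
              ∃₂ λ i j → i ≢ j × f i ≡ f j
  collision {f} f∈X with pigeonhole (n<1+n (length X)) position
    where
    position : Fin (suc (length X)) → Fin (length X)
    position i = index (f∈X (toℕ i) (s≤s⁻¹ (toℕ<n i)))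
  ... | i , j , i<j , same-position = toℕ i , toℕ j , <⇒≢ i<j , (begin
    f (toℕ i)                              ≡⟨ lookup-index (f∈X (toℕ i) _) ⟩
    lookup X (index (f∈X (toℕ i) _))       ≡⟨ cong (lookup X) same-position ⟩
    lookup X (index (f∈X (toℕ j) _))       ≡⟨ sym (lookup-index (f∈X (toℕ j) _)) ⟩
    f (toℕ j)                              ∎)
    where open ≡-Reasoning

  data Path (s : A → A) : ℕ → A → A → Set where
    stay : ∀ {p} → p ∈ X → Path s 0 p p
    step : ∀ {k p q} → p ∈ X → Path s k (s p) q → Path s (suc k) p q

  module _ {s : A → A} where

    path-start : ∀ {k p q} → Path s k p q → p ∈ X
    path-start (stay p∈X)   = p∈X
    path-start (step p∈X _) = p∈X

    path-end : ∀ {k p q} → Path s k p q → q ∈ X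
    path-end (stay q∈X)   = q∈X
    path-end (step _ path) = path-end path

    path-snoc : ∀ {k p q} → Path s k p q → s q ∈ X → Path s (suc k) p (s q)
    path-snoc (stay p∈X)     sp∈X = step p∈X (stay sp∈X)
    path-snoc (step p∈X path) sq∈X = step p∈X (path-snoc path sq∈X)

    path-points : ∀ {k p q} → Path s k p q → ∀ i → i ≤ k → iterate s p i ∈ X
    path-points path         zero    _         = path-start path
    path-points (step _ path) (suc i) (s≤s i≤k) = path-points path i i≤k

    no-long-path : Aperiodic s → ∀ {p q} → ¬ Path s (length X) p q
    no-long-path aperiodic {p} path =
      let i , j , i≢j , same = collision (path-points path) in i≢j (aperiodic p same)

  path-reverse : ∀ {s s⁻ : A → A} → (∀ a → s⁻ (s a) ≡ a) →
                 ∀ {k p q} → Path s k p q → Path s⁻ k q p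
  path-reverse inv (stay p∈X) = stay p∈X
  path-reverse {s⁻ = s⁻} inv {suc k} {p} (step p∈X path) =
    subst (Path s⁻ (suc k) _) (inv p)
      (path-snoc (path-reverse inv path) (subst (_∈ X) (sym (inv p)) p∈X))

  walk : (A → A) → ℕ → A → A
  walk s zero    p = p
  walk s (suc n) p with s p ∈X?
  ... | yes _ = walk s n (s p)
  ... | no  _ = p

  module _ {s : A → A} where

    walk-path : ∀ n {p} → p ∈ X → ∃ λ k → k ≤ n × Path s k p (walk s n p)
    walk-path zero    p∈X = 0 , z≤n , stay p∈X
    walk-path (suc n) {p} p∈X with s p ∈X?
    ... | yes sp∈X = let k , k≤n , path = walk-path n sp∈X in
                     suc k , s≤s k≤n , step p∈X path
    ... | no  _    = 0 , z≤n , stay p∈X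

    walk-exhausted : ∀ n {p} → p ∈ X → s (walk s n p) ∈ X → Path s n p (walk s n p)
    walk-exhausted zero    p∈X _ = stay p∈X
    walk-exhausted (suc n) {p} p∈X next with s p ∈X?
    ... | yes sp∈X = step p∈X (walk-exhausted n sp∈X next)
    ... | no  sp∉X = ⊥-elim (sp∉X next)

    walk-follows : ∀ {n k p q} → Path s k p q → k ≤ n → s q ∉ X → walk s n p ≡ q
    walk-follows {zero}  (stay _) _ _ = refl
    walk-follows {suc n} {p = p} (stay _) _ sq∉X with s p ∈X?
    ... | yes sp∈X = ⊥-elim (sq∉X sp∈X)
    ... | no  _    = refl
    walk-follows {suc n} {p = p} (step _ path) (s≤s k≤n) sq∉X with s p ∈X?
    ... | yes _    = walk-follows path k≤n sq∉X
    ... | no  sp∉X = ⊥-elim (sp∉X (path-start path))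

  run-end : ∀ {s} → Aperiodic s → ∀ {p} → p ∈ X →
            walk s (length X) p ∈ X × s (walk s (length X) p) ∉ X
  run-end aperiodic p∈X =
    let _ , _ , path = walk-path (length X) p∈X in
    path-end path , λ next → no-long-path aperiodic (walk-exhausted (length X) p∈X next)

  run-start : ∀ {s s⁻} → (∀ a → s⁻ (s a) ≡ a) → ∀ {p} → p ∈ X → s⁻ p ∉ X →
              walk s⁻ (length X) (walk s (length X) p) ≡ p
  run-start inv p∈X s⁻p∉X =
    let _ , k≤L , path = walk-path (length X) p∈X in
    walk-follows (path-reverse inv path) k≤L s⁻p∉X

_·ᵥ_ : ∀ {d} → ℕ → Pt d → Pt d
k ·ᵥ v = map (+ k ℤ.*_) v

negᵥ : ∀ {d} → Pt d → Pt d
negᵥ = map (λ b → ℤ.- b)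

+ᵥ-−ᵥ-cancelʳ : ∀ {d} (p v : Pt d) → (p +ᵥ v) -ᵥ v ≡ p
+ᵥ-−ᵥ-cancelʳ []      []      = refl
+ᵥ-−ᵥ-cancelʳ (a ∷ p) (b ∷ v) = cong₂ _∷_ (law a b) (+ᵥ-−ᵥ-cancelʳ p v)
  where law : ∀ a b → (a ℤ.+ b) ℤ.- b ≡ a
        law = solve-∀

−ᵥ-+ᵥ-cancelʳ : ∀ {d} (p v : Pt d) → (p -ᵥ v) +ᵥ v ≡ p
−ᵥ-+ᵥ-cancelʳ []      []      = refl
−ᵥ-+ᵥ-cancelʳ (a ∷ p) (b ∷ v) = cong₂ _∷_ (law a b) (−ᵥ-+ᵥ-cancelʳ p v)
  where law : ∀ a b → (a ℤ.- b) ℤ.+ b ≡ a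
        law = solve-∀

+ᵥ-−ᵥ-cancelˡ : ∀ {d} (p v : Pt d) → (p +ᵥ v) -ᵥ p ≡ v
+ᵥ-−ᵥ-cancelˡ []      []      = refl
+ᵥ-−ᵥ-cancelˡ (a ∷ p) (b ∷ v) = cong₂ _∷_ (law a b) (+ᵥ-−ᵥ-cancelˡ p v)
  where law : ∀ a b → (a ℤ.+ b) ℤ.- a ≡ b
        law = solve-∀

−ᵥ-−ᵥ-cancelˡ : ∀ {d} (p v : Pt d) → p -ᵥ (p -ᵥ v) ≡ v
−ᵥ-−ᵥ-cancelˡ []      []      = refl
−ᵥ-−ᵥ-cancelˡ (a ∷ p) (b ∷ v) = cong₂ _∷_ (law a b) (−ᵥ-−ᵥ-cancelˡ p v)
  where law : ∀ a b → a ℤ.- (a ℤ.- b) ≡ b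
        law = solve-∀

+ᵥ-−ᵥ-difference : ∀ {d} (p q : Pt d) → p +ᵥ (q -ᵥ p) ≡ q
+ᵥ-−ᵥ-difference []      []      = refl
+ᵥ-−ᵥ-difference (a ∷ p) (b ∷ q) = cong₂ _∷_ (law a b) (+ᵥ-−ᵥ-difference p q)
  where law : ∀ a b → a ℤ.+ (b ℤ.- a) ≡ b
        law = solve-∀

-- The identity x + x' = y + y' for  (y , x) ↦ (x' , x' + (x - y)).
exchange : ∀ {d} (x y e : Pt d) → x +ᵥ e ≡ y +ᵥ (e +ᵥ (x -ᵥ y))
exchange []      []      []      = refl
exchange (a ∷ x) (b ∷ y) (c ∷ e) = cong₂ _∷_ (law a b c) (exchange x y e)
  where law : ∀ a b c → a ℤ.+ c ≡ b ℤ.+ (c ℤ.+ (a ℤ.- b))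
        law = solve-∀

−ᵥ-is-+ᵥ-negᵥ : ∀ {d} (p v : Pt d) → p -ᵥ v ≡ p +ᵥ negᵥ v
−ᵥ-is-+ᵥ-negᵥ []      []      = refl
−ᵥ-is-+ᵥ-negᵥ (a ∷ p) (b ∷ v) = cong (a ℤ.- b ∷_) (−ᵥ-is-+ᵥ-negᵥ p v)

negᵥ-≡-0 : ∀ {d} (v : Pt d) → negᵥ v ≡ 0ᵈ → v ≡ 0ᵈ
negᵥ-≡-0 []      _ = refl
negᵥ-≡-0 (b ∷ v) e =
  let -b≡0 , -v≡0 = ∷-injective e in
  cong₂ _∷_ (trans (sym (ℤP.neg-involutive b)) (cong (λ c → ℤ.- c) -b≡0)) (negᵥ-≡-0 v -v≡0)

+ᵥ-·ᵥ-zero : ∀ {d} (p w : Pt d) → p +ᵥ (0 ·ᵥ w) ≡ p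
+ᵥ-·ᵥ-zero []      []      = refl
+ᵥ-·ᵥ-zero (a ∷ p) (b ∷ w) = cong₂ _∷_ (ℤP.+-identityʳ a) (+ᵥ-·ᵥ-zero p w)

+ᵥ-·ᵥ-suc : ∀ {d} (p w : Pt d) k → (p +ᵥ w) +ᵥ (k ·ᵥ w) ≡ p +ᵥ (suc k ·ᵥ w)
+ᵥ-·ᵥ-suc []      []      k = refl
+ᵥ-·ᵥ-suc (a ∷ p) (b ∷ w) k = cong₂ _∷_ (law a b (+ k)) (+ᵥ-·ᵥ-suc p w k)
  where law : ∀ a b c → (a ℤ.+ b) ℤ.+ c ℤ.* b ≡ a ℤ.+ (ℤ.+ 1 ℤ.+ c) ℤ.* b
        law = solve-∀

+ᵥ-cancelˡ : ∀ {d} (p u w : Pt d) → p +ᵥ u ≡ p +ᵥ w → u ≡ w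
+ᵥ-cancelˡ p u w e = begin
  u                ≡⟨ sym (+ᵥ-−ᵥ-cancelˡ p u) ⟩
  (p +ᵥ u) -ᵥ p    ≡⟨ cong (_-ᵥ p) e ⟩
  (p +ᵥ w) -ᵥ p    ≡⟨ +ᵥ-−ᵥ-cancelˡ p w ⟩
  w                ∎
  where open ≡-Reasoning

·-cancelʳ : ∀ i j (b : ℤ) → + i ℤ.* b ≡ + j ℤ.* b → i ≡ j ⊎ b ≡ 0ℤ
·-cancelʳ i j (+ zero)      _ = inj₂ refl
·-cancelʳ i j b@(+[1+ _ ])  e = inj₁ (ℤP.+-injective (ℤP.*-cancelʳ-≡ (+ i) (+ j) b e))
·-cancelʳ i j b@(-[1+ _ ])  e = inj₁ (ℤP.+-injective (ℤP.*-cancelʳ-≡ (+ i) (+ j) b e))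

·ᵥ-cancelʳ : ∀ {d} i j (w : Pt d) → i ·ᵥ w ≡ j ·ᵥ w → i ≡ j ⊎ w ≡ 0ᵈ
·ᵥ-cancelʳ i j []      _ = inj₂ refl
·ᵥ-cancelʳ i j (b ∷ w) e with ∷-injective e
... | head , tail with ·-cancelʳ i j b head
...   | inj₁ i≡j = inj₁ i≡j
...   | inj₂ b≡0 = map₂ (cong₂ _∷_ b≡0) (·ᵥ-cancelʳ i j w tail)

iterate-translation : ∀ {d} {s : Pt d → Pt d} {w : Pt d} → (∀ q → s q ≡ q +ᵥ w) →
                      ∀ p k → iterate s p k ≡ p +ᵥ (k ·ᵥ w)
iterate-translation {w = w} _ p zero = sym (+ᵥ-·ᵥ-zero p w)
iterate-translation {s = s} {w} translate p (suc k) = begin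
  iterate s (s p) k        ≡⟨ iterate-translation translate (s p) k ⟩
  s p +ᵥ (k ·ᵥ w)          ≡⟨ cong (_+ᵥ (k ·ᵥ w)) (translate p) ⟩
  (p +ᵥ w) +ᵥ (k ·ᵥ w)     ≡⟨ +ᵥ-·ᵥ-suc p w k ⟩
  p +ᵥ (suc k ·ᵥ w)        ∎
  where open ≡-Reasoning

translation-aperiodic : ∀ {d} {s : Pt d → Pt d} {w : Pt d} → w ≢ 0ᵈ →
                        (∀ q → s q ≡ q +ᵥ w) → Aperiodic s
translation-aperiodic {w = w} w≢0 translate p {i} {j} same =
  [ id , ⊥-elim ∘ w≢0 ]′ (·ᵥ-cancelʳ i j w (+ᵥ-cancelˡ p _ _ (begin
    p +ᵥ (i ·ᵥ w) ≡⟨ sym (iterate-translation translate p i) ⟩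
    _             ≡⟨ same ⟩
    _             ≡⟨ iterate-translation translate p j ⟩
    p +ᵥ (j ·ᵥ w) ∎)))
  where open ≡-Reasoning

-- Elements of X_in and X_out are determined by their underlying pair, since
-- proofs of  T b  are unique.
T³-irrelevant : ∀ {a b c : Bool} (u w : T a × T b × T c) → u ≡ w
T³-irrelevant (u₁ , u₂ , u₃) (w₁ , w₂ , w₃) =
  cong₂ _,_ (T-irrelevant u₁ w₁) (cong₂ _,_ (T-irrelevant u₂ w₂) (T-irrelevant u₃ w₃))

pair-≡ : ∀ {A B : Set} {P : A × B → Set} → (∀ {a b} (u w : P (a , b)) → u ≡ w) →
         {p q : Σ (A × B) P} → proj₁ p ≡ proj₁ q → p ≡ q
pair-≡ irrelevant {(a , b) , u} {_ , w} refl = cong ((a , b) ,_) (irrelevant u w)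

module Boundary {d} (N : List (Pt d)) (N∌0 : All (_≢ 0ᵈ) N) (X : List (Pt d)) where
  open Runs (≡-dec ℤ._≟_) X

  runEnd runStart : Pt d → Pt d → Pt d
  runEnd   v = walk (_+ᵥ v) (length X)
  runStart v = walk (_-ᵥ v) (length X)

  runEndPair runStartPair : Pt d → Pt d → Pt d × Pt d
  runEndPair   v x  = runEnd v x , runEnd v x +ᵥ v
  runStartPair v x' = runStart v x' -ᵥ v , runStart v x'

  forward-aperiodic : ∀ {v} → True (v ∈? N) → Aperiodic (_+ᵥ v)
  forward-aperiodic v∈N = translation-aperiodic (All.lookup N∌0 (toWitness v∈N)) λ _ → refl

  backward-aperiodic : ∀ {v} → True (v ∈? N) → Aperiodic (_-ᵥ v)
  backward-aperiodic {v} v∈N =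
    translation-aperiodic (All.lookup N∌0 (toWitness v∈N) ∘ negᵥ-≡-0 v)
                          (λ q → −ᵥ-is-+ᵥ-negᵥ q v)

  to : Xin N X → Xout N X
  to ((y , x) , y∉X , x∈X , v∈N) =
    runEndPair v x , fromWitness (proj₁ end) , fromWitnessFalse (proj₂ end) ,
    fromWitness (subst (_∈ N) (sym (+ᵥ-−ᵥ-cancelˡ (runEnd v x) v)) (toWitness v∈N))
    where
    v = x -ᵥ y
    end = run-end (forward-aperiodic v∈N) (toWitness x∈X)

  from : Xout N X → Xin N X
  from ((x' , y') , x'∈X , y'∉X , v∈N) =
    runStartPair v x' , fromWitnessFalse (proj₂ start) , fromWitness (proj₁ start) ,
    fromWitness (subst (_∈ N) (sym (−ᵥ-−ᵥ-cancelˡ (runStart v x') v)) (toWitness v∈N))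
    where
    v = y' -ᵥ x'
    start = run-end (backward-aperiodic v∈N) (toWitness x'∈X)

  from-to : ∀ p → from (to p) ≡ p
  from-to ((y , x) , y∉X , x∈X , _) = pair-≡ T³-irrelevant (begin
    runStartPair ((e +ᵥ v) -ᵥ e) e ≡⟨ cong (λ w → runStartPair w e) (+ᵥ-−ᵥ-cancelˡ e v) ⟩
    runStartPair v e               ≡⟨ cong (λ a → a -ᵥ v , a) back-to-start ⟩
    (x -ᵥ v , x)                   ≡⟨ cong (_, x) (−ᵥ-−ᵥ-cancelˡ x y) ⟩
    (y , x)                        ∎)
    where
    open ≡-Reasoning
    v = x -ᵥ y
    e = runEnd v x
    back-to-start : runStart v e ≡ x
    back-to-start = run-start (λ a → +ᵥ-−ᵥ-cancelʳ a v) (toWitness x∈X)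
      (toWitnessFalse y∉X ∘ subst (_∈ X) (−ᵥ-−ᵥ-cancelˡ x y))

  to-from : ∀ q → to (from q) ≡ q
  to-from ((x' , y') , x'∈X , y'∉X , _) = pair-≡ T³-irrelevant (begin
    runEndPair (a -ᵥ (a -ᵥ v)) a ≡⟨ cong (λ w → runEndPair w a) (−ᵥ-−ᵥ-cancelˡ a v) ⟩
    runEndPair v a               ≡⟨ cong (λ e → e , e +ᵥ v) back-to-end ⟩
    (x' , x' +ᵥ v)               ≡⟨ cong (x' ,_) (+ᵥ-−ᵥ-difference x' y') ⟩
    (x' , y')                    ∎)
    where
    open ≡-Reasoning
    v = y' -ᵥ x'
    a = runStart v x'
    back-to-end : runEnd v a ≡ x'
    back-to-end = run-start (λ b → −ᵥ-+ᵥ-cancelʳ b v) (toWitness x'∈X)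
      (toWitnessFalse y'∉X ∘ subst (_∈ X) (+ᵥ-−ᵥ-difference x' y'))

  bijection : Xin N X ⤖ Xout N X
  bijection = ↔⇒⤖ (mk↔ₛ′ to from to-from from-to)

  balanced : ∀ (p : Xin N X) →
             proj₂ (proj₁ p) +ᵥ proj₁ (proj₁ (Bijection.to bijection p))
               ≡ proj₁ (proj₁ p) +ᵥ proj₂ (proj₁ (Bijection.to bijection p))
  balanced ((y , x) , _) = exchange x y _

lemma1 : (d : ℕ) (N : List (Pt d)) → All (λ v → v ≢ 0ᵈ) N →
    (X : List (Pt d)) → X ≢ [] →
    Σ (Xin N X ⤖ Xout N X) λ lam →
      ∀ (p : Xin N X) →
        proj₂ (proj₁ p) +ᵥ proj₁ (proj₁ (Bijection.to lam p))
          ≡ proj₁ (proj₁ p) +ᵥ proj₂ (proj₁ (Bijection.to lam p))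
lemma1 d N N∌0 X _ = Boundary.bijection N N∌0 X , Boundary.balanced N N∌0 X
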